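{- Let $m\ge 5$ and $3\le k\le m-1$, and let $r\in\mathbb N_0$. If $k$ is odd and $\pi(r)<F_{m-k}$, then $\pi(r+F_k)=\pi(r)+F_m-F_{m-k}$. If $k$ is even and $\pi(r)\geq F_m-F_{m-k}$, then $\pi(r+F_k)=\pi(r)-(F_m-F_{m-k})$.
   Context: Fibonacci numbers: $F_1=F_2=1$, $F_k=F_{k-1}+F_{k-2}$. For fixed $m$, $\pi:\mathbb N_0\to\{0,\dots,F_m-1\}$ is $\pi(k)=F_m\{kF_{m-2}/F_m\}=kF_{m-2}\bmod F_m$, where $\{x\}$ is the fractional part. -}

module Defs where

open import Data.Nat using (ℕ; zero; suc; _+_; _*_; _∸_; NonZero; _%_)

F : ℕ → ℕ
F zero = zero
F (suc zero) = suc zero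
F (suc (suc k)) = F (suc k) + F k

F-suc-nonZero : ∀ n → NonZero (F (suc n))
F-suc-nonZero zero = _
F-suc-nonZero (suc zero) = _
F-suc-nonZero (suc (suc n)) with F (suc (suc n)) | F-suc-nonZero (suc n)
... | suc a | _ = _

-- π_m(r) = r * F_{m-2} mod F_m.  For m = 0 (where F_0 = 0) we return 0;
-- this case never arises in the statement (m ≥ 5).
π : ℕ → ℕ → ℕ
π zero r = zero
π (suc n) r = (r * F (suc n ∸ 2)) % F (suc n) where instance _ = F-suc-nonZero n

module Submission where

-- Write k = 2 + t and m = 2 + j + t, so that m − k = j and m − 2 = j + t.
-- Then π_m(r) is r·F_{j+t} reduced modulo F_m, and shifting r by F_k adds
-- F_k·F_{j+t} before the reduction.  Everything rests on the d'Ocagne-type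
-- identity
--     F_{t+2}·F_{j+t} − F_t·F_{j+t+2} = (−1)^t · F_j,
-- proved over ℤ from Cassini's identity by a two-step induction on j.  Read in
-- ℕ it says F_k·F_{m−2} = F_{k−2}·F_m + F_{m−k} for even k and
-- F_k·F_{m−2} + F_{m−k} = F_{k−2}·F_m for odd k, i.e. the shift adds F_{m−k},
-- respectively subtracts it, modulo F_m.  Two general facts about remainders
-- finish the proof: adding y ≡ P (mod M) wraps the remainder of x downwards
-- when x mod M ≥ M − P, and adding y ≡ −P wraps it upwards when x mod M < P.
-- The argument works for all 2 ≤ k ≤ m.

open import Defs
open import Data.Nat using (ℕ; zero; suc; NonZero; _+_; _*_; _∸_; _%_; _/_; _<_; _≤_; _≥_; _≤′_; ≤′-refl; ≤′-step; z≤n; s≤s)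
open import Data.Nat.Properties
  using (+-assoc; +-comm; +-cancelʳ-≡; +-monoˡ-<; +-cancelʳ-<; ≤-refl; ≤-trans; ≤-<-trans;
         <-≤-trans; <⇒≤; ≤⇒≤′; m≤m+n; m≤n+m; m∸n≤m; m∸n+n≡m; m+n∸n≡m; *-distribʳ-+)
open import Data.Nat.DivMod using (m≡m%n+[m/n]*n; [m+kn]%n≡m%n; m<n⇒m%n≡m; m%n<n)
open import Data.Nat.Divisibility using (_∣_; divides; ∣-refl; ∣m+n∣m⇒∣n; ∣m∣n⇒∣m+n; ∣⇒≤)
import Data.Nat.Tactic.RingSolver as ℕ-Ring
open import Data.Integer using (ℤ; +_; -_; 1ℤ; -1ℤ; 0ℤ; _^_)
  renaming (_+_ to _⊕_; _*_ to _⊛_; _-_ to _⊖_)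
open import Data.Integer.Properties using (pos-*; +-injective; *-identityˡ; -1*i≡-i)
import Data.Integer.Tactic.RingSolver as ℤ-Ring
open import Data.Empty using (⊥-elim)
open import Data.Product using (Σ-syntax; _×_; _,_)
open import Relation.Nullary using (¬_)
open import Relation.Binary.PropositionalEquality
  using (_≡_; refl; sym; trans; cong; cong₂; subst; subst₂; module ≡-Reasoning)
open ≡-Reasoning

2∣2+t⇒2∣t : ∀ {t} → 2 ∣ 2 + t → 2 ∣ t
2∣2+t⇒2∣t d = ∣m+n∣m⇒∣n d ∣-refl

2∤2+t⇒2∤t : ∀ {t} → ¬ 2 ∣ 2 + t → ¬ 2 ∣ t
2∤2+t⇒2∤t 2∤2+t 2∣t = 2∤2+t (∣m∣n⇒∣m+n ∣-refl 2∣t)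

double-negation : ∀ x → -1ℤ ⊛ (-1ℤ ⊛ x) ≡ x
double-negation = ℤ-Ring.solve-∀

sign-even : ∀ t → 2 ∣ t → -1ℤ ^ t ≡ 1ℤ
sign-even zero          _     = refl
sign-even (suc zero)    2∣1   with ∣⇒≤ 2∣1
... | s≤s ()
sign-even (suc (suc t)) 2∣2+t = trans (double-negation (-1ℤ ^ t)) (sign-even t (2∣2+t⇒2∣t 2∣2+t))

sign-odd : ∀ t → ¬ 2 ∣ t → -1ℤ ^ t ≡ -1ℤ
sign-odd zero          2∤0   = ⊥-elim (2∤0 (divides 0 refl))
sign-odd (suc zero)    _     = refl
sign-odd (suc (suc t)) 2∤2+t = trans (double-negation (-1ℤ ^ t)) (sign-odd t (2∤2+t⇒2∤t 2∤2+t))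

Fℤ : ℕ → ℤ
Fℤ n = + F n

cassini : ∀ t → Fℤ (2 + t) ⊛ Fℤ (1 + t) ⊖ Fℤ t ⊛ Fℤ (3 + t) ≡ -1ℤ ^ t
cassini zero    = refl
cassini (suc t) = trans (step (Fℤ t) (Fℤ (1 + t))) (cong (-1ℤ ⊛_) (cassini t))
  where
  -- with a = F_t, b = F_{t+1}, the next Cassini expression is minus the current one
  step : ∀ a b → ((b ⊕ a) ⊕ b) ⊛ (b ⊕ a) ⊖ b ⊛ (((b ⊕ a) ⊕ b) ⊕ (b ⊕ a))
               ≡ -1ℤ ⊛ ((b ⊕ a) ⊛ b ⊖ a ⊛ ((b ⊕ a) ⊕ b))
  step = ℤ-Ring.solve-∀

-- d'Ocagne's identity F_{t+2}·F_{j+t} − F_t·F_{j+t+2} = (−1)^t·F_j.  For fixed t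
-- both sides satisfy the Fibonacci recurrence in j; j = 0 is trivial and j = 1
-- is Cassini's identity.
d'Ocagne : ∀ t j → Fℤ (2 + t) ⊛ Fℤ (j + t) ⊖ Fℤ t ⊛ Fℤ (2 + j + t) ≡ -1ℤ ^ t ⊛ Fℤ j
d'Ocagne t zero          = vanish (Fℤ (2 + t)) (Fℤ t) (-1ℤ ^ t)
  where
  vanish : ∀ a b s → a ⊛ b ⊖ b ⊛ a ≡ s ⊛ 0ℤ
  vanish = ℤ-Ring.solve-∀
d'Ocagne t (suc zero)    = trans (cassini t) (unit (-1ℤ ^ t))
  where
  unit : ∀ s → s ≡ s ⊛ 1ℤ
  unit = ℤ-Ring.solve-∀
d'Ocagne t (suc (suc j)) = begin
    a ⊛ (Fℤ (1 + j + t) ⊕ Fℤ (j + t)) ⊖ b ⊛ (Fℤ (3 + j + t) ⊕ Fℤ (2 + j + t))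
  ≡⟨ split a b (Fℤ (1 + j + t)) (Fℤ (j + t)) (Fℤ (3 + j + t)) (Fℤ (2 + j + t)) ⟩
    (a ⊛ Fℤ (1 + j + t) ⊖ b ⊛ Fℤ (3 + j + t)) ⊕ (a ⊛ Fℤ (j + t) ⊖ b ⊛ Fℤ (2 + j + t))
  ≡⟨ cong₂ _⊕_ (d'Ocagne t (suc j)) (d'Ocagne t j) ⟩
    s ⊛ Fℤ (suc j) ⊕ s ⊛ Fℤ j
  ≡⟨ factor s (Fℤ (suc j)) (Fℤ j) ⟩
    s ⊛ Fℤ (suc (suc j))
  ∎
  where
  a = Fℤ (2 + t)
  b = Fℤ t
  s = -1ℤ ^ t
  split : ∀ a b u v p q → a ⊛ (u ⊕ v) ⊖ b ⊛ (p ⊕ q) ≡ (a ⊛ u ⊖ b ⊛ p) ⊕ (a ⊛ v ⊖ b ⊛ q)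
  split = ℤ-Ring.solve-∀
  factor : ∀ s c d → s ⊛ c ⊕ s ⊛ d ≡ s ⊛ (c ⊕ d)
  factor = ℤ-Ring.solve-∀

difference-pos : ∀ a b c → + a ⊖ + b ≡ + c → a ≡ b + c
difference-pos a b c eq = +-injective (begin
    + a                ≡⟨ regroup (+ a) (+ b) ⟩
    + b ⊕ (+ a ⊖ + b)  ≡⟨ cong (+ b ⊕_) eq ⟩
    + b ⊕ + c          ∎)
  where
  regroup : ∀ x y → x ≡ y ⊕ (x ⊖ y)
  regroup = ℤ-Ring.solve-∀

difference-neg : ∀ a b c → + a ⊖ + b ≡ - + c → a + c ≡ b
difference-neg a b c eq = +-injective (begin
    + a ⊕ + c                  ≡⟨ regroup (+ a) (+ b) (+ c) ⟩
    + b ⊕ ((+ a ⊖ + b) ⊕ + c)  ≡⟨ cong (λ d → + b ⊕ (d ⊕ + c)) eq ⟩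
    + b ⊕ (- + c ⊕ + c)        ≡⟨ cancel (+ b) (+ c) ⟩
    + b                        ∎)
  where
  regroup : ∀ x y z → x ⊕ z ≡ y ⊕ ((x ⊖ y) ⊕ z)
  regroup = ℤ-Ring.solve-∀
  cancel : ∀ y z → y ⊕ (- z ⊕ z) ≡ y
  cancel = ℤ-Ring.solve-∀

d'Ocagne-ℕ : ∀ t j → + (F (2 + t) * F (j + t)) ⊖ + (F t * F (2 + j + t)) ≡ -1ℤ ^ t ⊛ Fℤ j
d'Ocagne-ℕ t j =
  trans (cong₂ _⊖_ (pos-* (F (2 + t)) (F (j + t))) (pos-* (F t) (F (2 + j + t)))) (d'Ocagne t j)

d'Ocagne-even : ∀ t j → 2 ∣ t → F (2 + t) * F (j + t) ≡ F t * F (2 + j + t) + F j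
d'Ocagne-even t j 2∣t = difference-pos _ _ (F j) (begin
    + (F (2 + t) * F (j + t)) ⊖ + (F t * F (2 + j + t))  ≡⟨ d'Ocagne-ℕ t j ⟩
    -1ℤ ^ t ⊛ Fℤ j                                      ≡⟨ cong (_⊛ Fℤ j) (sign-even t 2∣t) ⟩
    1ℤ ⊛ Fℤ j                                           ≡⟨ *-identityˡ (Fℤ j) ⟩
    Fℤ j                                                ∎)

d'Ocagne-odd : ∀ t j → ¬ 2 ∣ t → F (2 + t) * F (j + t) + F j ≡ F t * F (2 + j + t)
d'Ocagne-odd t j 2∤t = difference-neg _ _ (F j) (begin
    + (F (2 + t) * F (j + t)) ⊖ + (F t * F (2 + j + t))  ≡⟨ d'Ocagne-ℕ t j ⟩
    -1ℤ ^ t ⊛ Fℤ j                                      ≡⟨ cong (_⊛ Fℤ j) (sign-odd t 2∤t) ⟩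
    -1ℤ ⊛ Fℤ j                                          ≡⟨ -1*i≡-i (Fℤ j) ⟩
    - Fℤ j                                              ∎)

%-of-normal-form : ∀ M .{{_ : NonZero M}} a D → a < M → (a + D * M) % M ≡ a
%-of-normal-form M a D a<M = trans ([m+kn]%n≡m%n a D M) (m<n⇒m%n≡m a<M)

%-of-sum : ∀ M .{{_ : NonZero M}} x y a D → a < M → x % M + y ≡ a + D * M → (x + y) % M ≡ a
%-of-sum M x y a D a<M eq = trans (cong (_% M) normal-form) (%-of-normal-form M a (x / M + D) a<M)
  where
  normal-form : x + y ≡ a + (x / M + D) * M
  normal-form = begin
    x + y                      ≡⟨ cong (_+ y) (m≡m%n+[m/n]*n x M) ⟩
    x % M + x / M * M + y      ≡⟨ swap (x % M) (x / M * M) y ⟩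
    (x % M + y) + x / M * M    ≡⟨ cong (_+ x / M * M) eq ⟩
    a + D * M + x / M * M      ≡⟨ collect a D (x / M) M ⟩
    a + (x / M + D) * M        ∎
    where
    swap : ∀ p q y → p + q + y ≡ (p + y) + q
    swap = ℕ-Ring.solve-∀
    collect : ∀ a D q M → a + D * M + q * M ≡ a + (q + D) * M
    collect = ℕ-Ring.solve-∀

%-wrap-down : ∀ M .{{_ : NonZero M}} x y P C → y ≡ C * M + P → P ≤ M → x % M ≥ M ∸ P →
              (x + y) % M ≡ x % M ∸ (M ∸ P)
%-wrap-down M x y P C refl P≤M M-P≤p = %-of-sum M x (C * M + P) a (suc C) a<M shifted
  where
  p = x % M
  a = p ∸ (M ∸ P)
  a<M : a < M
  a<M = ≤-<-trans (m∸n≤m p (M ∸ P)) (m%n<n x M)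
  p+P≡a+M : p + P ≡ a + M
  p+P≡a+M = begin
    p + P              ≡⟨ cong (_+ P) (sym (m∸n+n≡m M-P≤p)) ⟩
    a + (M ∸ P) + P    ≡⟨ +-assoc a (M ∸ P) P ⟩
    a + ((M ∸ P) + P)  ≡⟨ cong (λ n → a + n) (m∸n+n≡m P≤M) ⟩
    a + M              ∎
  shifted : p + (C * M + P) ≡ a + suc C * M
  shifted = begin
    p + (C * M + P)  ≡⟨ regroup p C M P ⟩
    (p + P) + C * M  ≡⟨ cong (_+ C * M) p+P≡a+M ⟩
    (a + M) + C * M  ≡⟨ +-assoc a M (C * M) ⟩
    a + suc C * M    ∎
    where
    regroup : ∀ p C M P → p + (C * M + P) ≡ (p + P) + C * M
    regroup = ℕ-Ring.solve-∀

%-wrap-up : ∀ M .{{_ : NonZero M}} x y P C → y + P ≡ C * M → P ≤ M → x % M < P →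
            (x + y) % M ≡ x % M + M ∸ P
%-wrap-up M x y P zero    y+P≡0 _   p<P with <-≤-trans p<P (subst (P ≤_) y+P≡0 (m≤n+m P y))
... | ()
%-wrap-up M x y P (suc C) y+P≡M+CM P≤M p<P = %-of-sum M x y a C a<M shifted
  where
  p = x % M
  a = p + M ∸ P
  a+P≡p+M : a + P ≡ p + M
  a+P≡p+M = m∸n+n≡m (≤-trans P≤M (m≤n+m M p))
  a<M : a < M
  a<M = +-cancelʳ-< P a M (subst₂ _<_ (sym a+P≡p+M) (+-comm P M) (+-monoˡ-< M p<P))
  shifted : p + y ≡ a + C * M
  shifted = +-cancelʳ-≡ P (p + y) (a + C * M) (begin
    p + y + P          ≡⟨ +-assoc p y P ⟩
    p + (y + P)        ≡⟨ cong (λ n → p + n) y+P≡M+CM ⟩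
    p + (M + C * M)    ≡⟨ sym (+-assoc p M (C * M)) ⟩
    (p + M) + C * M    ≡⟨ cong (_+ C * M) (sym a+P≡p+M) ⟩
    (a + P) + C * M    ≡⟨ swap a P (C * M) ⟩
    a + C * M + P      ∎)
    where
    swap : ∀ a P q → a + P + q ≡ a + q + P
    swap = ℕ-Ring.solve-∀

F-step : ∀ n → F n ≤ F (suc n)
F-step zero    = z≤n
F-step (suc n) = m≤m+n (F (suc n)) (F n)

F-mono : ∀ {m n} → m ≤ n → F m ≤ F n
F-mono m≤n = along (≤⇒≤′ m≤n)
  where
  along : ∀ {m n} → m ≤′ n → F m ≤ F n
  along ≤′-refl           = ≤-refl
  along (≤′-step {n} m≤n) = ≤-trans (along m≤n) (F-step n)

module Shift (t j r : ℕ) where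
  M : ℕ
  M = F (2 + j + t)
  instance
    M≢0 : NonZero M
    M≢0 = F-suc-nonZero (suc (j + t))

  Fj≤M : F j ≤ M
  Fj≤M = F-mono (≤-trans (m≤m+n j t) (m≤n+m (j + t) 2))

  unfold-shift : π (2 + j + t) (r + F (2 + t)) ≡ (r * F (j + t) + F (2 + t) * F (j + t)) % M
  unfold-shift = cong (_% M) (*-distribʳ-+ (F (j + t)) r (F (2 + t)))

  shift-even : 2 ∣ 2 + t → π (2 + j + t) r ≥ M ∸ F j →
               π (2 + j + t) (r + F (2 + t)) ≡ π (2 + j + t) r ∸ (M ∸ F j)
  shift-even 2∣k above = trans unfold-shift
    (%-wrap-down M _ _ (F j) (F t) (d'Ocagne-even t j (2∣2+t⇒2∣t 2∣k)) Fj≤M above)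

  shift-odd : ¬ 2 ∣ 2 + t → π (2 + j + t) r < F j →
              π (2 + j + t) (r + F (2 + t)) ≡ π (2 + j + t) r + M ∸ F j
  shift-odd 2∤k below = trans unfold-shift
    (%-wrap-up M _ _ (F j) (F t) (d'Ocagne-odd t j (2∤2+t⇒2∤t 2∤k)) Fj≤M below)

split-indices : ∀ {k m} → 2 ≤ k → k ≤ m → Σ[ t ∈ ℕ ] Σ[ j ∈ ℕ ] k ≡ 2 + t × m ≡ 2 + j + t
split-indices {suc (suc t)} {suc (suc n)} (s≤s (s≤s z≤n)) (s≤s (s≤s t≤n)) =
  t , n ∸ t , refl , cong (λ i → 2 + i) (sym (m∸n+n≡m t≤n))

lemma3 : (m k r : ℕ) → 5 ≤ m → 3 ≤ k → k ≤ m ∸ 1 →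
    ((¬ (2 ∣ k) → π m r < F (m ∸ k) → π m (r + F k) ≡ π m r + F m ∸ F (m ∸ k))
    × (2 ∣ k → π m r ≥ F m ∸ F (m ∸ k) → π m (r + F k) ≡ π m r ∸ (F m ∸ F (m ∸ k))))
lemma3 m k r _ 3≤k k≤m-1 with split-indices (<⇒≤ 3≤k) (≤-trans k≤m-1 (m∸n≤m m 1))
... | t , j , refl , refl rewrite m+n∸n≡m j t = shift-odd , shift-even
  where open Shift t j r
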